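{- Let $d_1,d_2$ be positive integers and $1\le m\le 3$ an integer with $3\mid d_1+d_2+m+1$, and let $F=B(d_1,m,d_2)$. Let $\chi$ be a $\mathbb{Z}_3$-coloring of the edges of $K_{d_1+d_2+m+2}$ with $\alpha_{C_4}(\chi)\ge 1$ such that there is an alternating $4$-cycle $C$ for which the coloring restricted to $K_{d_1+d_2+m+2}-V(C)$ is not monochromatic. Then $K_{d_1+d_2+m+2}$ contains a copy of $F$ whose edge colors sum to $0$ in $\mathbb{Z}_3$.
   Context: $B(d_1,m,d_2)$ is the tree consisting of two vertices $p_1,p_2$ joined by a path with $m$ internal vertices, where $p_i$ additionally has $d_i$ leaf neighbors ($i=1,2$); it has $d_1+d_2+m+2$ vertices. For a $\mathbb{Z}_3$-coloring $\chi$ of a complete graph, a $4$-cycle is alternating if the sums of the colors on its two perfect matchings are distinct, and $\alpha_{C_4}(\chi)$ is the maximum number of pairwise vertex-disjoint alternating $4$-cycles. -}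

module Defs where

open import Data.Nat using (ℕ; _+_; _%_)
open import Data.Fin using (Fin; toℕ)
open import Data.List using (List; []; _∷_; map; allFin; _++_)
open import Data.Nat.ListAction using (sum)
open import Data.Product using (_×_; _,_; Σ; ∃; proj₁; proj₂)
open import Relation.Binary.PropositionalEquality using (_≡_; _≢_)
open import Relation.Nullary using (¬_)
open import Function.Definitions using (Injective)
open import Data.Sum using (_⊎_)
open import Data.List.Membership.Propositional using (_∈_)
open import Data.List using (length)

-- A Z₃-coloring of the edges of K_n: colors are Fin 3 (= Z₃), given as a
-- symmetric function on pairs of vertices (values on the diagonal are irrelevant).
Coloring : ℕ → Set
Coloring n = Fin n → Fin n → Fin 3

Symmetric : ∀ {n} → Coloring n → Set
Symmetric {n} χ = ∀ (x y : Fin n) → χ x y ≡ χ y x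

_+₃_ : Fin 3 → Fin 3 → ℕ
a +₃ b = (toℕ a + toℕ b) % 3

record FourCycle (n : ℕ) : Set where
  constructor cyc
  field
    a b c d : Fin n
    a≢b : a ≢ b
    a≢c : a ≢ c
    a≢d : a ≢ d
    b≢c : b ≢ c
    b≢d : b ≢ d
    c≢d : c ≢ d
open FourCycle public

InCycle : ∀ {n} → FourCycle n → Fin n → Set
InCycle C x = (x ≡ a C) ⊎ ((x ≡ b C) ⊎ ((x ≡ c C) ⊎ (x ≡ d C)))

-- Alternating: the color sums of the two perfect matchings {ab,cd}, {bc,da} differ.
Alternating : ∀ {n} → Coloring n → FourCycle n → Set
Alternating χ C = (χ (a C) (b C) +₃ χ (c C) (d C)) ≢ (χ (b C) (c C) +₃ χ (d C) (a C))

Disjoint : ∀ {n} → FourCycle n → FourCycle n → Set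
Disjoint {n} C D = ∀ (x : Fin n) → InCycle C x → ¬ InCycle D x

data PairwiseDisjointAlt {n} (χ : Coloring n) : List (FourCycle n) → Set where
  []  : PairwiseDisjointAlt χ []
  _∷_ : ∀ {C Cs} → (Alternating χ C × (∀ {D} → D ∈ Cs → Disjoint C D))
        → PairwiseDisjointAlt χ Cs → PairwiseDisjointAlt χ (C ∷ Cs)

αC4≥ : ∀ {n} → Coloring n → ℕ → Set
αC4≥ {n} χ k = Σ (List (FourCycle n)) λ Cs → (length Cs ≡ k) × PairwiseDisjointAlt χ Cs

NotMonoOutside : ∀ {n} → Coloring n → FourCycle n → Set
NotMonoOutside {n} χ C =
  Σ (Fin n) λ x → Σ (Fin n) λ y → Σ (Fin n) λ z → Σ (Fin n) λ w →
    (x ≢ y) × (z ≢ w) ×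
    (¬ InCycle C x) × (¬ InCycle C y) × (¬ InCycle C z) × (¬ InCycle C w) ×
    (χ x y ≢ χ z w)

data BVert (d₁ m d₂ : ℕ) : Set where
  p₁ p₂ : BVert d₁ m d₂
  int   : Fin m → BVert d₁ m d₂      -- internal path vertices q₀,…,q_{m-1}
  leaf₁ : Fin d₁ → BVert d₁ m d₂
  leaf₂ : Fin d₂ → BVert d₁ m d₂

consecutive : ∀ {A : Set} → List A → List (A × A)
consecutive []           = []
consecutive (x ∷ [])     = []
consecutive (x ∷ y ∷ xs) = (x , y) ∷ consecutive (y ∷ xs)

BEdges : (d₁ m d₂ : ℕ) → List (BVert d₁ m d₂ × BVert d₁ m d₂)
BEdges d₁ m d₂ =
  consecutive (p₁ ∷ (map int (allFin m) ++ (p₂ ∷ [])))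
  ++ map (λ i → (p₁ , leaf₁ i)) (allFin d₁)
  ++ map (λ j → (p₂ , leaf₂ j)) (allFin d₂)

ZeroSumCopyB : ∀ {n} → Coloring n → (d₁ m d₂ : ℕ) → Set
ZeroSumCopyB {n} χ d₁ m d₂ =
  Σ (BVert d₁ m d₂ → Fin n) λ f → Injective _≡_ _≡_ f ×
    (sum (map (λ e → toℕ (χ (f (proj₁ e)) (f (proj₂ e)))) (BEdges d₁ m d₂)) % 3 ≡ 0)

-- For a copy g of the tree let w(g) be its colour sum. If transpositions s, t of tree vertices
-- touch disjoint sets of tree edges, the copies g, g∘s, g∘t, g∘s∘t have sums K+P+Q, K+P′+Q,
-- K+P+Q′, K+P′+Q′, and when P ≢ P′ and Q ≢ Q′ (mod 3) one of them is 0 (mod 3), because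
-- {P,P′} + {Q,Q′} has at least three elements in ℤ₃.
--
-- For d₁ ≥ 2 (and, by mirroring, d₂ ≥ 2) let s exchange a leaf of p₁ with a leaf of p₂, and t a
-- second leaf of p₁ with the neighbour q₀ of p₁. Then s changes w when p₁, p₂ and the two leaves
-- span an alternating 4-cycle, which C provides, and t changes w when the other neighbour of q₀
-- sees the two exchanged vertices in different colours, which two adjacent differently coloured
-- edges outside C provide (they exist as χ is not monochromatic there). For m = 1 that neighbour
-- is p₂ itself, and a short case analysis places such a pair of edges at a corner of an
-- alternating 4-cycle. The divisibility condition leaves only the path d₁ = d₂ = 1, m = 3; there
-- t exchanges q₁ and q₂ (using C), and s exchanges either the two leaves (using a second
-- alternating 4-cycle through the cherry) or p₁ with the leaf of p₂.
module Submission where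

open import Defs
open import Data.Nat using (ℕ; zero; suc; _+_; _*_; _%_; _≤_; s≤s)
import Data.Nat as ℕ
open import Data.Nat.Properties using (+-comm; +-identityʳ)
open import Data.Nat.DivMod using (_mod_; %-distribˡ-+; m%n%n≡m%n; m%n<n; m<n⇒m%n≡m; [m+kn]%n≡m%n)
open import Data.Nat.Divisibility using (_∣_; _∣?_)
open import Data.Nat.ListAction using (sum)
open import Data.Nat.ListAction.Properties using (sum-++)
open import Data.Nat.Tactic.RingSolver using (solve-∀)
open import Data.Fin using (Fin; zero; suc; toℕ; #_; opposite; inject₁; fromℕ)
open import Data.Fin.Properties using (_≟_; all?; toℕ-injective; toℕ<n; toℕ-fromℕ<; +↔⊎; opposite-involutive)
open import Data.List using (List; []; _∷_; map; tabulate; allFin; lookup; zip; _++_; reverse; _ʳ++_; _∷ʳ_)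
open import Data.List.Properties using (map-++; map-∘; map-tabulate; reverse-map; reverse-++)
open import Data.List.Membership.Propositional.Properties using (∈-lookup)
open import Data.List.Relation.Unary.All as All using (All; []; _∷_)
import Data.List.Relation.Unary.All.Properties as All
open import Data.List.Relation.Unary.AllPairs as AllPairs using (AllPairs; []; _∷_; allPairs?)
import Data.List.Relation.Unary.AllPairs.Properties as AllPairs
open import Data.Product using (Σ; _×_; _,_; proj₁; proj₂; uncurry)
open import Data.Sum using (_⊎_; inj₁; inj₂)
import Data.Sum.Properties as Sum
open import Data.Sum.Function.Propositional using (_⊎-↔_)
open import Data.Bool using (if_then_else_)
open import Data.Empty using (⊥-elim)
open import Function using (_∘_; id; case_of_; _↣_; _↔_; mk↣; Injection)
open import Function.Definitions using (Injective)
open import Function.Properties.Inverse using (↔-sym; ↔-trans; ↔-refl; Inverse⇒Injection)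
open import Function.Construct.Composition using (_↣-∘_)
open import Relation.Binary.Definitions using (DecidableEquality)
open import Relation.Binary.PropositionalEquality
open import Relation.Nullary using (¬_; Dec; does; map′; yes; no)
open import Relation.Nullary.Decidable using (True; toWitness; from-no; dec-true; dec-false; ¬?; _→-dec_; _⊎-dec_)

infix 4 _≡₃_
_≡₃_ : ℕ → ℕ → Set
k ≡₃ l = k % 3 ≡ l % 3

+-cong₃ : ∀ k k′ l l′ → k ≡₃ k′ → l ≡₃ l′ → k + l ≡₃ k′ + l′
+-cong₃ k k′ l l′ k≡k′ l≡l′ = begin
  (k + l) % 3             ≡⟨ %-distribˡ-+ k l 3 ⟩
  (k % 3 + l % 3) % 3     ≡⟨ cong₂ (λ u v → (u + v) % 3) k≡k′ l≡l′ ⟩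
  (k′ % 3 + l′ % 3) % 3   ≡⟨ %-distribˡ-+ k′ l′ 3 ⟨
  (k′ + l′) % 3           ∎
  where open ≡-Reasoning

toℕ-mod₃ : ∀ k → toℕ (k mod 3) ≡₃ k
toℕ-mod₃ k = trans (cong (_% 3) (toℕ-fromℕ< (m%n<n k 3))) (m%n%n≡m%n k 3)

mod₃-≢ : ∀ k l → k % 3 ≢ l % 3 → k mod 3 ≢ l mod 3
mod₃-≢ k l k≢l k≡l =
  k≢l (trans (sym (toℕ-fromℕ< (m%n<n k 3))) (trans (cong toℕ k≡l) (toℕ-fromℕ< (m%n<n l 3))))

toℕ-≢₃ : ∀ {u v : Fin 3} → u ≢ v → toℕ u % 3 ≢ toℕ v % 3
toℕ-≢₃ {u} {v} u≢v eq =
  u≢v (toℕ-injective (trans (sym (m<n⇒m%n≡m (toℕ<n u))) (trans eq (m<n⇒m%n≡m (toℕ<n v)))))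

sum₃ : Fin 3 → Fin 3 → Fin 3 → ℕ
sum₃ u v w = (toℕ u + toℕ v + toℕ w) % 3

sum₃-mod : ∀ k l j → sum₃ (k mod 3) (l mod 3) (j mod 3) ≡ (k + l + j) % 3
sum₃-mod k l j =
  +-cong₃ (toℕ (k mod 3) + toℕ (l mod 3)) (k + l) (toℕ (j mod 3)) j
    (+-cong₃ (toℕ (k mod 3)) k (toℕ (l mod 3)) l (toℕ-mod₃ k) (toℕ-mod₃ l)) (toℕ-mod₃ j)

-- In ℤ₃ the set {p, p′} + {q, q′} has at least three elements, so it contains −k.
zero-among-four-residues : ∀ (k p p′ q q′ : Fin 3) → p ≢ p′ → q ≢ q′ →
  sum₃ k p q ≡ 0 ⊎ sum₃ k p′ q ≡ 0 ⊎ sum₃ k p q′ ≡ 0 ⊎ sum₃ k p′ q′ ≡ 0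
zero-among-four-residues = toWitness {a? = all? λ k → all? λ p → all? λ p′ → all? λ q → all? λ q′ →
  ¬? (p ≟ p′) →-dec ¬? (q ≟ q′) →-dec
  ((sum₃ k p q ℕ.≟ 0) ⊎-dec (sum₃ k p′ q ℕ.≟ 0) ⊎-dec
   (sum₃ k p q′ ℕ.≟ 0) ⊎-dec (sum₃ k p′ q′ ℕ.≟ 0))} _

zero-among-four-sums : ∀ K P P′ Q Q′ → P % 3 ≢ P′ % 3 → Q % 3 ≢ Q′ % 3 →
  (K + P + Q) % 3 ≡ 0 ⊎ (K + P′ + Q) % 3 ≡ 0 ⊎ (K + P + Q′) % 3 ≡ 0 ⊎ (K + P′ + Q′) % 3 ≡ 0
zero-among-four-sums K P P′ Q Q′ P≢P′ Q≢Q′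
  with zero-among-four-residues (K mod 3) (P mod 3) (P′ mod 3) (Q mod 3) (Q′ mod 3)
         (mod₃-≢ P P′ P≢P′) (mod₃-≢ Q Q′ Q≢Q′)
... | inj₁ z               = inj₁ (trans (sym (sum₃-mod K P Q)) z)
... | inj₂ (inj₁ z)        = inj₂ (inj₁ (trans (sym (sum₃-mod K P′ Q)) z))
... | inj₂ (inj₂ (inj₁ z)) = inj₂ (inj₂ (inj₁ (trans (sym (sum₃-mod K P Q′)) z)))
... | inj₂ (inj₂ (inj₂ z)) = inj₂ (inj₂ (inj₂ (trans (sym (sum₃-mod K P′ Q′)) z)))

+-cancelˡ-≢₃ : ∀ k l l′ → l % 3 ≢ l′ % 3 → (k + l) % 3 ≢ (k + l′) % 3
+-cancelˡ-≢₃ k l l′ l≢l′ k+l≡k+l′ = l≢l′ (begin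
  l % 3                   ≡⟨ [m+kn]%n≡m%n l k 3 ⟨
  (l + k * 3) % 3         ≡⟨ cong (_% 3) (shift k l) ⟩
  (k + k + (k + l)) % 3   ≡⟨ +-cong₃ (k + k) (k + k) (k + l) (k + l′) refl k+l≡k+l′ ⟩
  (k + k + (k + l′)) % 3  ≡⟨ cong (_% 3) (shift k l′) ⟨
  (l′ + k * 3) % 3        ≡⟨ [m+kn]%n≡m%n l′ k 3 ⟩
  l′ % 3                  ∎)
  where
  open ≡-Reasoning
  shift : ∀ k l → l + k * 3 ≡ k + k + (k + l)
  shift = solve-∀

+-cancelʳ-≢₃ : ∀ k l l′ → l % 3 ≢ l′ % 3 → (l + k) % 3 ≢ (l′ + k) % 3
+-cancelʳ-≢₃ k l l′ l≢l′ eq =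
  +-cancelˡ-≢₃ k l l′ l≢l′ (trans (cong (_% 3) (+-comm k l)) (trans eq (cong (_% 3) (+-comm l′ k))))

+₃-comm : ∀ (u v : Fin 3) → (u +₃ v) ≡ (v +₃ u)
+₃-comm u v = cong (_% 3) (+-comm (toℕ u) (toℕ v))

-- In ℤ₃ the hypotheses say cy − cx = ay − ax = zy − zx ≠ 0, so the two sums differ by zx − zy.
sums-differ-by-shift : ∀ (zx zy cx cy ax ay : Fin 3) → zx ≢ zy →
  (zx +₃ cy) ≡ (zy +₃ cx) → (zx +₃ ay) ≡ (zy +₃ ax) →
  (toℕ ax + (toℕ zx + toℕ cy)) % 3 ≢ (toℕ ay + (toℕ zy + toℕ cx)) % 3
sums-differ-by-shift = toWitness {a? = all? λ zx → all? λ zy → all? λ cx → all? λ cy → all? λ ax → all? λ ay →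
  ¬? (zx ≟ zy) →-dec ((zx +₃ cy) ℕ.≟ (zy +₃ cx)) →-dec ((zx +₃ ay) ℕ.≟ (zy +₃ ax)) →-dec
  ¬? ((toℕ ax + (toℕ zx + toℕ cy)) % 3 ℕ.≟ (toℕ ay + (toℕ zy + toℕ cx)) % 3)} _

-- Exchanging u and v between p and q changes the colour sum; for symmetric χ this says that
-- the 4-cycle p u q v is alternating.
AltSquare : ∀ {n} → Coloring n → Fin n → Fin n → Fin n → Fin n → Set
AltSquare χ p u q v = (χ p u +₃ χ q v) ≢ (χ p v +₃ χ q u)

AltSquare-sym : ∀ {n} (χ : Coloring n) p u q v → AltSquare χ p u q v → AltSquare χ q v p u
AltSquare-sym χ p u q v square eq =
  square (trans (+₃-comm (χ p u) (χ q v)) (trans eq (+₃-comm (χ q u) (χ p v))))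

-- Exchanging p with l, where p is joined to q and k, and l to r, changes the colour sum.
EndSwap : ∀ {n} → Coloring n → Fin n → Fin n → Fin n → Fin n → Fin n → Set
EndSwap χ p q k r l =
  (toℕ (χ p q) + (toℕ (χ p k) + toℕ (χ r l))) % 3 ≢ (toℕ (χ l q) + (toℕ (χ l k) + toℕ (χ r p))) % 3

Bicoloured : ∀ {n} → Coloring n → Fin n → Fin n → Fin n → Set
Bicoloured χ x z y = χ x z ≢ χ y z

module _ {A : Set} (_≟ᴬ_ : DecidableEquality A) where

  transpose : A → A → A → A
  transpose r s t = if does (t ≟ᴬ r) then s else if does (t ≟ᴬ s) then r else t

  transpose-mapsˡ : ∀ r s → transpose r s r ≡ s
  transpose-mapsˡ r s rewrite dec-true (r ≟ᴬ r) refl = refl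

  transpose-mapsʳ : ∀ r s → transpose r s s ≡ r
  transpose-mapsʳ r s with s ≟ᴬ r
  ... | yes s≡r = s≡r
  ... | no _ rewrite dec-true (s ≟ᴬ s) refl = refl

  transpose-fixes : ∀ {r s t} → t ≢ r → t ≢ s → transpose r s t ≡ t
  transpose-fixes {r} {s} {t} t≢r t≢s rewrite dec-false (t ≟ᴬ r) t≢r | dec-false (t ≟ᴬ s) t≢s = refl

  transpose-involutive : ∀ r s t → transpose r s (transpose r s t) ≡ t
  transpose-involutive r s t = by-cases (t ≟ᴬ r) (t ≟ᴬ s)
    where
    by-cases : Dec (t ≡ r) → Dec (t ≡ s) → transpose r s (transpose r s t) ≡ t
    by-cases (yes refl) _          = trans (cong (transpose t s) (transpose-mapsˡ t s)) (transpose-mapsʳ t s)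
    by-cases (no _)     (yes refl) = trans (cong (transpose r t) (transpose-mapsʳ r t)) (transpose-mapsˡ r t)
    by-cases (no t≢r)   (no t≢s)   =
      trans (cong (transpose r s) (transpose-fixes t≢r t≢s)) (transpose-fixes t≢r t≢s)

  transpose-injective : ∀ r s → Injective _≡_ _≡_ (transpose r s)
  transpose-injective r s {t} {u} eq = begin
    t                                 ≡⟨ transpose-involutive r s t ⟨
    transpose r s (transpose r s t)   ≡⟨ cong (transpose r s) eq ⟩
    transpose r s (transpose r s u)   ≡⟨ transpose-involutive r s u ⟩
    u                                 ∎
    where open ≡-Reasoning

module _ {A B : Set} (_≟ᴮ_ : DecidableEquality B) where

  relocate : (A → B) → A → B → A → B
  relocate f r v = transpose _≟ᴮ_ (f r) v ∘ f

  relocate-injective : ∀ {f} r v → Injective _≡_ _≡_ f → Injective _≡_ _≡_ (relocate f r v)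
  relocate-injective {f} r v f-inj = f-inj ∘ transpose-injective _≟ᴮ_ (f r) v

  place : (A → B) → List A → List B → A → B
  place f (r ∷ rs) (v ∷ vs) = place (relocate f r v) rs vs
  place f []       _        = f
  place f (_ ∷ _)  []       = f

  place-injective : ∀ {f} rs vs → Injective _≡_ _≡_ f → Injective _≡_ _≡_ (place f rs vs)
  place-injective (r ∷ rs) (v ∷ vs) f-inj = place-injective rs vs (relocate-injective r v f-inj)
  place-injective []       _        f-inj = f-inj
  place-injective (_ ∷ _)  []       f-inj = f-inj

  place-fixes : ∀ {f r} rs vs → Injective _≡_ _≡_ f → All (r ≢_) rs → All (f r ≢_) vs →
                place f rs vs r ≡ f r
  place-fixes {f} {r} (r′ ∷ rs) (v ∷ vs) f-inj (r≢r′ ∷ r∉rs) (fr≢v ∷ fr∉vs) =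
    trans (place-fixes rs vs (relocate-injective r′ v f-inj) r∉rs
                       (subst (λ u → All (u ≢_) vs) (sym r-stays) fr∉vs))
          r-stays
    where
    r-stays : relocate f r′ v r ≡ f r
    r-stays = transpose-fixes _≟ᴮ_ (r≢r′ ∘ f-inj) fr≢v
  place-fixes []      _  _ _ _ = refl
  place-fixes (_ ∷ _) [] _ _ _ = refl

  place-sends : ∀ {f} rs vs → Injective _≡_ _≡_ f → AllPairs _≢_ rs → AllPairs _≢_ vs →
                All (uncurry λ r v → place f rs vs r ≡ v) (zip rs vs)
  place-sends {f} (r ∷ rs) (v ∷ vs) f-inj (r∉rs ∷ rs-distinct) (v∉vs ∷ vs-distinct) =
    trans (place-fixes rs vs (relocate-injective r v f-inj) r∉rs (subst (λ u → All (u ≢_) vs) (sym r↦v) v∉vs)) r↦v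
    ∷ place-sends rs vs (relocate-injective r v f-inj) rs-distinct vs-distinct
    where
    r↦v : relocate f r v r ≡ v
    r↦v = transpose-mapsˡ _≟ᴮ_ (f r) v
  place-sends []      _  _ _ _ = []
  place-sends (_ ∷ _) [] _ _ _ = []

distinct-by-decision : ∀ {A : Set} (_≟ᴬ_ : DecidableEquality A) (xs : List A) →
  {True (allPairs? (λ x y → ¬? (x ≟ᴬ y)) xs)} → AllPairs _≢_ xs
distinct-by-decision _≟ᴬ_ xs {distinct} = toWitness distinct

lookup-injective : ∀ {A : Set} {xs : List A} → AllPairs _≢_ xs → Injective _≡_ _≡_ (lookup xs)
lookup-injective (_ ∷ _)            {zero}  {zero}  _  = refl
lookup-injective (x∉xs ∷ _)         {zero}  {suc j} eq = ⊥-elim (All.lookup x∉xs (∈-lookup j) eq)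
lookup-injective (x∉xs ∷ _)         {suc i} {zero}  eq = ⊥-elim (All.lookup x∉xs (∈-lookup i) (sym eq))
lookup-injective (_ ∷ xs-distinct)  {suc i} {suc j} eq = cong suc (lookup-injective xs-distinct eq)

allFin-suc : ∀ k → allFin (suc k) ≡ zero ∷ map suc (allFin k)
allFin-suc k = cong (zero ∷_) (sym (map-tabulate id suc))

allFin-∷ʳ : ∀ k → allFin (suc k) ≡ map inject₁ (allFin k) ∷ʳ fromℕ k
allFin-∷ʳ zero    = refl
allFin-∷ʳ (suc k) = begin
  allFin (suc (suc k))                                        ≡⟨ allFin-suc (suc k) ⟩
  zero ∷ map suc (allFin (suc k))                             ≡⟨ cong (λ is → zero ∷ map suc is) (allFin-∷ʳ k) ⟩
  zero ∷ map suc (map inject₁ (allFin k) ∷ʳ fromℕ k)          ≡⟨ cong (zero ∷_) (map-++ suc (map inject₁ (allFin k)) _) ⟩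
  zero ∷ (map suc (map inject₁ (allFin k)) ∷ʳ fromℕ (suc k))  ≡⟨ cong (λ is → zero ∷ (is ∷ʳ fromℕ (suc k))) commute ⟩
  zero ∷ (map inject₁ (map suc (allFin k)) ∷ʳ fromℕ (suc k))  ≡⟨ cong (λ is → map inject₁ is ∷ʳ fromℕ (suc k)) (allFin-suc k) ⟨
  map inject₁ (allFin (suc k)) ∷ʳ fromℕ (suc k)               ∎
  where
  open ≡-Reasoning
  commute : map suc (map inject₁ (allFin k)) ≡ map inject₁ (map suc (allFin k))
  commute = trans (sym (map-∘ (allFin k))) (map-∘ (allFin k))

map-opposite-allFin : ∀ k → map opposite (allFin k) ≡ reverse (allFin k)
map-opposite-allFin zero    = refl
map-opposite-allFin (suc k) = begin
  map opposite (allFin (suc k))                     ≡⟨ cong (map opposite) (allFin-suc k) ⟩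
  fromℕ k ∷ map opposite (map suc (allFin k))       ≡⟨ cong (fromℕ k ∷_) (trans (sym (map-∘ (allFin k))) (map-∘ (allFin k))) ⟩
  fromℕ k ∷ map inject₁ (map opposite (allFin k))   ≡⟨ cong (λ is → fromℕ k ∷ map inject₁ is) (map-opposite-allFin k) ⟩
  fromℕ k ∷ map inject₁ (reverse (allFin k))        ≡⟨ cong (fromℕ k ∷_) (reverse-map inject₁ (allFin k)) ⟩
  fromℕ k ∷ reverse (map inject₁ (allFin k))        ≡⟨ reverse-++ (map inject₁ (allFin k)) (fromℕ k ∷ []) ⟨
  reverse (map inject₁ (allFin k) ∷ʳ fromℕ k)       ≡⟨ cong reverse (allFin-∷ʳ k) ⟨
  reverse (allFin (suc k))                          ∎
  where open ≡-Reasoning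

module _ {d₁ m d₂ : ℕ} where

  BCode : Set
  BCode = ((Fin d₁ ⊎ Fin d₂) ⊎ Fin m) ⊎ Fin 2

  encode : BVert d₁ m d₂ → BCode
  encode p₁        = inj₂ zero
  encode p₂        = inj₂ (suc zero)
  encode (int i)   = inj₁ (inj₂ i)
  encode (leaf₁ i) = inj₁ (inj₁ (inj₁ i))
  encode (leaf₂ j) = inj₁ (inj₁ (inj₂ j))

  decode : BCode → BVert d₁ m d₂
  decode (inj₂ zero)            = p₁
  decode (inj₂ (suc _))         = p₂
  decode (inj₁ (inj₂ i))        = int i
  decode (inj₁ (inj₁ (inj₁ i))) = leaf₁ i
  decode (inj₁ (inj₁ (inj₂ j))) = leaf₂ j

  decode-encode : ∀ r → decode (encode r) ≡ r
  decode-encode p₁        = refl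
  decode-encode p₂        = refl
  decode-encode (int i)   = refl
  decode-encode (leaf₁ i) = refl
  decode-encode (leaf₂ j) = refl

  encode-injective : Injective _≡_ _≡_ encode
  encode-injective {r} {s} eq = trans (sym (decode-encode r)) (trans (cong decode eq) (decode-encode s))

  -- Comparing codes makes transpositions of concrete vertices reduce, so the colour sums of
  -- switched copies below are computed rather than proved.
  _≟ᵥ_ : DecidableEquality (BVert d₁ m d₂)
  r ≟ᵥ s = map′ encode-injective (cong encode) (≡-dec (encode r) (encode s))
    where
    ≡-dec : DecidableEquality BCode
    ≡-dec = Sum.≡-dec (Sum.≡-dec (Sum.≡-dec _≟_ _≟_) _≟_) _≟_

  BVert↣Fin : BVert d₁ m d₂ ↣ Fin (d₁ + d₂ + m + 2)
  BVert↣Fin = Inverse⇒Injection BCode↔Fin ↣-∘ mk↣ encode-injective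
    where
    BCode↔Fin : BCode ↔ Fin (d₁ + d₂ + m + 2)
    BCode↔Fin = ↔-sym (↔-trans +↔⊎ (↔-trans +↔⊎ (+↔⊎ ⊎-↔ ↔-refl) ⊎-↔ ↔-refl))

  spine : List (BVert d₁ m d₂)
  spine = p₁ ∷ (map int (allFin m) ++ (p₂ ∷ []))

mirror : ∀ {d₁ m d₂} → BVert d₁ m d₂ → BVert d₂ m d₁
mirror p₁        = p₂
mirror p₂        = p₁
mirror (int i)   = int (opposite i)
mirror (leaf₁ i) = leaf₂ i
mirror (leaf₂ j) = leaf₁ j

mirror-involutive : ∀ {d₁ m d₂} (r : BVert d₁ m d₂) → mirror (mirror r) ≡ r
mirror-involutive p₁        = refl
mirror-involutive p₂        = refl
mirror-involutive (int i)   = cong int (opposite-involutive i)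
mirror-involutive (leaf₁ i) = refl
mirror-involutive (leaf₂ j) = refl

mirror-injective : ∀ {d₁ m d₂} → Injective _≡_ _≡_ (mirror {d₁} {m} {d₂})
mirror-injective {x = r} {s} eq = trans (sym (mirror-involutive r)) (trans (cong mirror eq) (mirror-involutive s))

map-mirror-spine : ∀ {d₁ m d₂} → map mirror (spine {d₁} {m} {d₂}) ≡ reverse spine
map-mirror-spine {m = m} = begin
  p₂ ∷ map mirror (map int (allFin m) ++ p₂ ∷ [])   ≡⟨ cong (p₂ ∷_) (map-++ mirror (map int (allFin m)) _) ⟩
  p₂ ∷ (map mirror (map int (allFin m)) ∷ʳ p₁)      ≡⟨ cong (λ is → p₂ ∷ (is ∷ʳ p₁)) internal ⟩
  p₂ ∷ (reverse (map int (allFin m)) ∷ʳ p₁)         ≡⟨ cong (_∷ʳ p₁) (reverse-++ (map int (allFin m)) (p₂ ∷ [])) ⟨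
  reverse (map int (allFin m) ++ p₂ ∷ []) ∷ʳ p₁     ≡⟨ reverse-++ (p₁ ∷ []) (map int (allFin m) ++ p₂ ∷ []) ⟨
  reverse spine                                     ∎
  where
  open ≡-Reasoning
  internal : map mirror (map int (allFin m)) ≡ reverse (map int (allFin m))
  internal = begin
    map mirror (map int (allFin m))     ≡⟨ trans (sym (map-∘ (allFin m))) (map-∘ (allFin m)) ⟩
    map int (map opposite (allFin m))   ≡⟨ cong (map int) (map-opposite-allFin m) ⟩
    map int (reverse (allFin m))        ≡⟨ reverse-map int (allFin m) ⟩
    reverse (map int (allFin m))        ∎

module _ {n : ℕ} (χ : Coloring n) where

  colour : ∀ {A : Set} → (A → Fin n) → A → A → ℕ
  colour g x y = toℕ (χ (g x) (g y))

  pathWeight : ∀ {A : Set} → (A → Fin n) → List A → ℕ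
  pathWeight g xs = sum (map (λ e → colour g (proj₁ e) (proj₂ e)) (consecutive xs))

  weight : ∀ {d₁ m d₂} → (BVert d₁ m d₂ → Fin n) → ℕ
  weight {d₁} {m} {d₂} g = sum (map (λ e → colour g (proj₁ e) (proj₂ e)) (BEdges d₁ m d₂))

  leafWeight₁ leafWeight₂ : ∀ {d₁ m d₂} → (BVert d₁ m d₂ → Fin n) → ℕ
  leafWeight₁ g = sum (tabulate (λ i → colour g p₁ (leaf₁ i)))
  leafWeight₂ g = sum (tabulate (λ j → colour g p₂ (leaf₂ j)))

  weight-split : ∀ {d₁ m d₂} (g : BVert d₁ m d₂ → Fin n) →
                 weight g ≡ pathWeight g spine + (leafWeight₁ g + leafWeight₂ g)
  weight-split {d₁} {m} {d₂} g = begin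
    sum (map κ (P ++ L₁ ++ L₂))                       ≡⟨ cong sum (map-++ κ P (L₁ ++ L₂)) ⟩
    sum (map κ P ++ map κ (L₁ ++ L₂))                 ≡⟨ sum-++ (map κ P) _ ⟩
    sum (map κ P) + sum (map κ (L₁ ++ L₂))            ≡⟨ cong (λ es → sum (map κ P) + sum es) (map-++ κ L₁ L₂) ⟩
    sum (map κ P) + sum (map κ L₁ ++ map κ L₂)        ≡⟨ cong (sum (map κ P) +_) (sum-++ (map κ L₁) (map κ L₂)) ⟩
    sum (map κ P) + (sum (map κ L₁) + sum (map κ L₂))
      ≡⟨ cong₂ (λ u v → sum (map κ P) + (u + v)) (star (λ i → (p₁ , leaf₁ i))) (star (λ j → (p₂ , leaf₂ j))) ⟩
    pathWeight g spine + (leafWeight₁ g + leafWeight₂ g) ∎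
    where
    open ≡-Reasoning
    Edge : Set
    Edge = BVert d₁ m d₂ × BVert d₁ m d₂
    κ : Edge → ℕ
    κ e = colour g (proj₁ e) (proj₂ e)
    P L₁ L₂ : List Edge
    P  = consecutive spine
    L₁ = map (λ i → (p₁ , leaf₁ i)) (allFin d₁)
    L₂ = map (λ j → (p₂ , leaf₂ j)) (allFin d₂)
    star : ∀ {k} (f : Fin k → Edge) → sum (map κ (map f (allFin k))) ≡ sum (tabulate (κ ∘ f))
    star f = cong sum (trans (sym (map-∘ (allFin _))) (map-tabulate id (κ ∘ f)))

  pathWeight-cong : ∀ {A : Set} {g h : A → Fin n} {xs} → All (λ x → g x ≡ h x) xs → pathWeight g xs ≡ pathWeight h xs
  pathWeight-cong []                    = refl
  pathWeight-cong (_ ∷ [])              = refl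
  pathWeight-cong (gx≡hx ∷ gy≡hy ∷ eqs) =
    cong₂ (λ u w → toℕ u + w) (cong₂ χ gx≡hx gy≡hy) (pathWeight-cong (gy≡hy ∷ eqs))

  pathWeight-map : ∀ {A B : Set} (g : B → Fin n) (f : A → B) xs → pathWeight (g ∘ f) xs ≡ pathWeight g (map f xs)
  pathWeight-map g f []           = refl
  pathWeight-map g f (_ ∷ [])     = refl
  pathWeight-map g f (x ∷ y ∷ xs) = cong (colour g (f x) (f y) +_) (pathWeight-map g f (y ∷ xs))

  module _ (χ-sym : Symmetric χ) {A : Set} (g : A → Fin n) where

    pathWeight-ʳ++ : ∀ xs x ys → pathWeight g (xs ʳ++ (x ∷ ys)) ≡ pathWeight g (x ∷ xs) + pathWeight g (x ∷ ys)
    pathWeight-ʳ++ []       x ys = refl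
    pathWeight-ʳ++ (y ∷ xs) x ys = begin
      pathWeight g (xs ʳ++ (y ∷ x ∷ ys))            ≡⟨ pathWeight-ʳ++ xs y (x ∷ ys) ⟩
      pathWeight g (y ∷ xs) + (colour g y x + W)    ≡⟨ cong (λ u → pathWeight g (y ∷ xs) + (toℕ u + W)) (χ-sym (g y) (g x)) ⟩
      pathWeight g (y ∷ xs) + (colour g x y + W)    ≡⟨ rearrange (pathWeight g (y ∷ xs)) (colour g x y) W ⟩
      colour g x y + pathWeight g (y ∷ xs) + W      ∎
      where
      open ≡-Reasoning
      W : ℕ
      W = pathWeight g (x ∷ ys)
      rearrange : ∀ u v w → u + (v + w) ≡ v + u + w
      rearrange = solve-∀

    pathWeight-reverse : ∀ xs → pathWeight g (reverse xs) ≡ pathWeight g xs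
    pathWeight-reverse []       = refl
    pathWeight-reverse (x ∷ xs) = trans (pathWeight-ʳ++ xs x []) (+-identityʳ _)

  weight-mirror : ∀ {d₁ m d₂} → Symmetric χ → (g : BVert d₂ m d₁ → Fin n) →
                  weight (g ∘ mirror {d₁} {m} {d₂}) ≡ weight g
  weight-mirror χ-sym g = begin
    weight (g ∘ mirror)                                                ≡⟨ weight-split (g ∘ mirror) ⟩
    pathWeight (g ∘ mirror) spine + (leafWeight₂ g + leafWeight₁ g)    ≡⟨ cong (_+ (leafWeight₂ g + leafWeight₁ g)) path ⟩
    pathWeight g spine + (leafWeight₂ g + leafWeight₁ g)               ≡⟨ cong (pathWeight g spine +_) (+-comm (leafWeight₂ g) _) ⟩
    pathWeight g spine + (leafWeight₁ g + leafWeight₂ g)               ≡⟨ weight-split g ⟨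
    weight g                                                           ∎
    where
    open ≡-Reasoning
    path : pathWeight (g ∘ mirror) spine ≡ pathWeight g spine
    path = begin
      pathWeight (g ∘ mirror) spine     ≡⟨ pathWeight-map g mirror spine ⟩
      pathWeight g (map mirror spine)   ≡⟨ cong (pathWeight g) map-mirror-spine ⟩
      pathWeight g (reverse spine)      ≡⟨ pathWeight-reverse χ-sym g spine ⟩
      pathWeight g spine                ∎

  ZeroSumCopyB-mirror : ∀ {d₁ m d₂} → Symmetric χ → ZeroSumCopyB χ d₂ m d₁ → ZeroSumCopyB χ d₁ m d₂
  ZeroSumCopyB-mirror χ-sym (g , g-inj , zero-sum) =
    g ∘ mirror , mirror-injective ∘ g-inj , trans (cong (_% 3) (weight-mirror χ-sym g)) zero-sum

  zeroSumCopy-by-switching :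
    ∀ {d₁ m d₂} (g : BVert d₁ m d₂ → Fin n) (s t : BVert d₁ m d₂ → BVert d₁ m d₂) →
    Injective _≡_ _≡_ g → Injective _≡_ _≡_ s → Injective _≡_ _≡_ t → ∀ {K P P′ Q Q′} →
    weight g ≡ K + P + Q → weight (g ∘ s) ≡ K + P′ + Q →
    weight (g ∘ t) ≡ K + P + Q′ → weight (g ∘ s ∘ t) ≡ K + P′ + Q′ →
    P % 3 ≢ P′ % 3 → Q % 3 ≢ Q′ % 3 → ZeroSumCopyB χ d₁ m d₂
  zeroSumCopy-by-switching g s t g-inj s-inj t-inj {K} {P} {P′} {Q} {Q′} w₀₀ w₁₀ w₀₁ w₁₁ P≢P′ Q≢Q′
    with zero-among-four-sums K P P′ Q Q′ P≢P′ Q≢Q′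
  ... | inj₁ z               = g , g-inj , trans (cong (_% 3) w₀₀) z
  ... | inj₂ (inj₁ z)        = g ∘ s , s-inj ∘ g-inj , trans (cong (_% 3) w₁₀) z
  ... | inj₂ (inj₂ (inj₁ z)) = g ∘ t , t-inj ∘ g-inj , trans (cong (_% 3) w₀₁) z
  ... | inj₂ (inj₂ (inj₂ z)) = g ∘ s ∘ t , t-inj ∘ s-inj ∘ g-inj , trans (cong (_% 3) w₁₁) z

-- Two leaves at p₁: d₁ ≥ 2

q₀-next : ∀ {d₁ m d₂} → BVert d₁ (suc m) d₂
q₀-next {m = zero}  = p₂
q₀-next {m = suc _} = int (suc zero)

spine-beyond : ∀ {d₁ m d₂} → List (BVert d₁ (suc m) d₂)
spine-beyond {m = zero}  = []
spine-beyond {m = suc _} = map int (tabulate (λ i → suc (suc i))) ++ p₂ ∷ []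

spine-unfold : ∀ {d₁ m d₂} → spine {d₁} {suc m} {d₂} ≡ p₁ ∷ int zero ∷ q₀-next ∷ spine-beyond
spine-unfold {m = zero}  = refl
spine-unfold {m = suc _} = refl

spine-beyond-fixed : ∀ {d₁ m d₂} (t : BVert d₁ (suc m) d₂ → BVert d₁ (suc m) d₂) →
  t p₂ ≡ p₂ → (∀ i → t (int (suc i)) ≡ int (suc i)) → All (λ r → t r ≡ r) (q₀-next ∷ spine-beyond)
spine-beyond-fixed {m = zero}  t fix-p₂ fix-int = fix-p₂ ∷ []
spine-beyond-fixed {m = suc _} t fix-p₂ fix-int =
  fix-int zero ∷ All.++⁺ (All.map⁺ (All.tabulate⁺ (λ i → fix-int (suc i)))) (fix-p₂ ∷ [])

module _ {n k₁ m k₂ : ℕ} (χ : Coloring n) where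
  private
    V : Set
    V = BVert (suc (suc k₁)) (suc m) (suc k₂)
    q₀ l₁₀ l₁₁ l₂₀ : V
    q₀  = int zero
    l₁₀ = leaf₁ zero
    l₁₁ = leaf₁ (suc zero)
    l₂₀ = leaf₂ zero

    swapLeaves swapQ₀ : V → V
    swapLeaves = transpose _≟ᵥ_ l₁₀ l₂₀
    swapQ₀     = transpose _≟ᵥ_ l₁₁ q₀

    swapLeaves-fixes-beyond : All (λ r → swapLeaves r ≡ r) (q₀-next ∷ spine-beyond)
    swapLeaves-fixes-beyond = spine-beyond-fixed swapLeaves refl (λ _ → refl)

    swapQ₀-fixes-beyond : All (λ r → swapQ₀ r ≡ r) (q₀-next ∷ spine-beyond)
    swapQ₀-fixes-beyond = spine-beyond-fixed swapQ₀ refl (λ _ → refl)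

    beyond-unchanged : ∀ g {t : V → V} → All (λ r → t r ≡ r) (q₀-next ∷ spine-beyond) →
                       pathWeight χ (g ∘ t) (q₀-next ∷ spine-beyond) ≡ pathWeight χ g (q₀-next ∷ spine-beyond)
    beyond-unchanged g fixes = pathWeight-cong χ (All.map (cong g) fixes)

    leafRest₁ leafRest₂ : (V → Fin n) → ℕ
    leafRest₁ g = sum (tabulate (λ i → colour χ g p₁ (leaf₁ (suc (suc i)))))
    leafRest₂ g = sum (tabulate (λ j → colour χ g p₂ (leaf₂ (suc j))))

    rest leafEdges q₀Edge : (V → Fin n) → ℕ
    rest g      = colour χ g p₁ q₀ + colour χ g p₁ l₁₁ + pathWeight χ g (q₀-next ∷ spine-beyond)
                + leafRest₁ g + leafRest₂ g
    leafEdges g = colour χ g p₁ l₁₀ + colour χ g p₂ l₂₀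
    q₀Edge g    = colour χ g q₀ q₀-next

    weight-parts : ∀ g → weight χ g ≡ rest g + leafEdges g + q₀Edge g
    weight-parts g = begin
      weight χ g
        ≡⟨ weight-split χ g ⟩
      pathWeight χ g spine + (leafWeight₁ χ g + leafWeight₂ χ g)
        ≡⟨ cong (λ xs → pathWeight χ g xs + (leafWeight₁ χ g + leafWeight₂ χ g)) spine-unfold ⟩
      pathWeight χ g (p₁ ∷ q₀ ∷ q₀-next ∷ spine-beyond) + (leafWeight₁ χ g + leafWeight₂ χ g)
        ≡⟨ rearrange (colour χ g p₁ q₀) (colour χ g q₀ q₀-next) (pathWeight χ g (q₀-next ∷ spine-beyond))
                     (colour χ g p₁ l₁₀) (colour χ g p₁ l₁₁) (leafRest₁ g) (colour χ g p₂ l₂₀) (leafRest₂ g) ⟩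
      rest g + leafEdges g + q₀Edge g
        ∎
      where
      open ≡-Reasoning
      rearrange : ∀ e₀ e₁ w x y t₁ z t₂ →
                  (e₀ + (e₁ + w)) + ((x + (y + t₁)) + (z + t₂)) ≡ e₀ + y + w + t₁ + t₂ + (x + z) + e₁
      rearrange = solve-∀

    reweigh : ∀ h {R Q} → rest h ≡ R → q₀Edge h ≡ Q → weight χ h ≡ R + leafEdges h + Q
    reweigh h R≡ Q≡ = trans (weight-parts h) (cong₂ (λ r q → r + leafEdges h + q) R≡ Q≡)

    rest-swapLeaves : ∀ g → rest (g ∘ swapLeaves) ≡ rest g
    rest-swapLeaves g = cong (λ w → colour χ g p₁ q₀ + colour χ g p₁ l₁₁ + w + leafRest₁ g + leafRest₂ g)
                             (beyond-unchanged g swapLeaves-fixes-beyond)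

    rest-swapQ₀ : ∀ g → rest (g ∘ swapQ₀) ≡ rest g
    rest-swapQ₀ g = cong₂ (λ u w → u + w + leafRest₁ g + leafRest₂ g)
                          (+-comm (colour χ g p₁ l₁₁) (colour χ g p₁ q₀)) (beyond-unchanged g swapQ₀-fixes-beyond)

    q₀Edge-swapLeaves : ∀ g → q₀Edge (g ∘ swapLeaves) ≡ q₀Edge g
    q₀Edge-swapLeaves g = cong (colour χ g q₀) (All.head swapLeaves-fixes-beyond)

    q₀Edge-swapQ₀ : ∀ g → q₀Edge (g ∘ swapQ₀) ≡ colour χ g l₁₁ q₀-next
    q₀Edge-swapQ₀ g = cong (colour χ g l₁₁) (All.head swapQ₀-fixes-beyond)

  zeroSumCopy-d₁≥2 : (g : BVert (suc (suc k₁)) (suc m) (suc k₂) → Fin n) → Injective _≡_ _≡_ g →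
    AltSquare χ (g p₁) (g (leaf₁ zero)) (g p₂) (g (leaf₂ zero)) →
    Bicoloured χ (g (int zero)) (g q₀-next) (g (leaf₁ (suc zero))) →
    ZeroSumCopyB χ (suc (suc k₁)) (suc m) (suc k₂)
  zeroSumCopy-d₁≥2 g g-inj square cherry =
    zeroSumCopy-by-switching χ g swapLeaves swapQ₀ g-inj
      (transpose-injective _≟ᵥ_ l₁₀ l₂₀) (transpose-injective _≟ᵥ_ l₁₁ q₀)
      {K = rest g} {leafEdges g} {leafEdges (g ∘ swapLeaves)} {q₀Edge g} {colour χ g l₁₁ q₀-next}
      (weight-parts g)
      (reweigh (g ∘ swapLeaves) (rest-swapLeaves g) (q₀Edge-swapLeaves g))
      (reweigh (g ∘ swapQ₀) (rest-swapQ₀ g) (q₀Edge-swapQ₀ g))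
      (reweigh (g ∘ swapLeaves ∘ swapQ₀)
        (trans (rest-swapQ₀ (g ∘ swapLeaves)) (rest-swapLeaves g))
        (trans (q₀Edge-swapQ₀ (g ∘ swapLeaves)) (cong (colour χ g l₁₁) (All.head swapLeaves-fixes-beyond))))
      square (toℕ-≢₃ cherry)

-- The path on seven vertices: d₁ = d₂ = 1, m = 3

module _ {n : ℕ} (χ : Coloring n) (χ-sym : Symmetric χ) where
  private
    V : Set
    V = BVert 1 3 1
    l₁ l₂ q₀ q₁ q₂ : V
    l₁ = leaf₁ zero
    l₂ = leaf₂ zero
    q₀ = int zero
    q₁ = int (suc zero)
    q₂ = int (suc (suc zero))

    swapMiddle : V → V
    swapMiddle = transpose _≟ᵥ_ q₁ q₂

    middleEdge endEdges sideEdges : (V → Fin n) → ℕ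
    middleEdge g = colour χ g q₁ q₂
    endEdges g   = colour χ g p₁ q₀ + (colour χ g p₁ l₁ + colour χ g p₂ l₂)
    sideEdges g  = colour χ g q₀ q₁ + colour χ g q₂ p₂

    weight-parts : ∀ g → weight χ g ≡ middleEdge g + endEdges g + sideEdges g
    weight-parts g = rearrange (colour χ g p₁ q₀) (colour χ g q₀ q₁) (middleEdge g) (colour χ g q₂ p₂)
                               (colour χ g p₁ l₁) (colour χ g p₂ l₂)
      where
      rearrange : ∀ e₁ e₂ e₃ e₄ e₅ e₆ →
                  e₁ + (e₂ + (e₃ + (e₄ + (e₅ + (e₆ + 0))))) ≡ e₃ + (e₁ + (e₅ + e₆)) + (e₂ + e₄)
      rearrange = solve-∀

    middleEdge-swapMiddle : ∀ g → middleEdge (g ∘ swapMiddle) ≡ middleEdge g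
    middleEdge-swapMiddle g = cong toℕ (χ-sym (g q₂) (g q₁))

    zeroSumCopy-path₇ : (g : V → Fin n) → Injective _≡_ _≡_ g → (s : V → V) → Injective _≡_ _≡_ s →
      All (λ r → s r ≡ r) (q₀ ∷ q₁ ∷ q₂ ∷ p₂ ∷ []) →
      AltSquare χ (g q₀) (g q₁) (g p₂) (g q₂) → endEdges g % 3 ≢ endEdges (g ∘ s) % 3 → ZeroSumCopyB χ 1 3 1
    zeroSumCopy-path₇ g g-inj s s-inj (s-q₀ ∷ s-q₁ ∷ s-q₂ ∷ s-p₂ ∷ []) square ends≢ =
      zeroSumCopy-by-switching χ g s swapMiddle g-inj s-inj (transpose-injective _≟ᵥ_ q₁ q₂)
        {K = middleEdge g} {endEdges g} {endEdges (g ∘ s)} {sideEdges g} {sideEdges (g ∘ swapMiddle)}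
        (weight-parts g)
        (trans (weight-parts (g ∘ s)) (cong₂ (λ u w → u + endEdges (g ∘ s) + w) middle-s sides-s))
        (trans (weight-parts (g ∘ swapMiddle))
               (cong (λ u → u + endEdges g + sideEdges (g ∘ swapMiddle)) (middleEdge-swapMiddle g)))
        (trans (weight-parts (g ∘ s ∘ swapMiddle))
               (cong₂ (λ u w → u + endEdges (g ∘ s) + w) (trans (middleEdge-swapMiddle (g ∘ s)) middle-s) sides-s∘swap))
        ends≢ (λ eq → square (trans (cong (χ (g q₀) (g q₁) +₃_) (χ-sym (g p₂) (g q₂)))
                             (trans eq (cong (χ (g q₀) (g q₂) +₃_) (χ-sym (g q₁) (g p₂))))))
      where
      colour-s : ∀ {x y} → s x ≡ x → s y ≡ y → colour χ (g ∘ s) x y ≡ colour χ g x y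
      colour-s = cong₂ (λ u w → toℕ (χ (g u) (g w)))
      middle-s : middleEdge (g ∘ s) ≡ middleEdge g
      middle-s = colour-s s-q₁ s-q₂
      sides-s : sideEdges (g ∘ s) ≡ sideEdges g
      sides-s = cong₂ _+_ (colour-s s-q₀ s-q₁) (colour-s s-q₂ s-p₂)
      sides-s∘swap : sideEdges (g ∘ s ∘ swapMiddle) ≡ sideEdges (g ∘ swapMiddle)
      sides-s∘swap = cong₂ _+_ (colour-s s-q₀ s-q₂) (colour-s s-q₁ s-p₂)

  zeroSumCopy-path₇-leaves : (g : V → Fin n) → Injective _≡_ _≡_ g →
    AltSquare χ (g q₀) (g q₁) (g p₂) (g q₂) → AltSquare χ (g p₁) (g l₁) (g p₂) (g l₂) → ZeroSumCopyB χ 1 3 1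
  zeroSumCopy-path₇-leaves g g-inj middle-square leaves-square =
    zeroSumCopy-path₇ g g-inj (transpose _≟ᵥ_ l₁ l₂) (transpose-injective _≟ᵥ_ l₁ l₂)
      (refl ∷ refl ∷ refl ∷ refl ∷ [])
      middle-square
      (+-cancelˡ-≢₃ (colour χ g p₁ q₀) (colour χ g p₁ l₁ + colour χ g p₂ l₂) (colour χ g p₁ l₂ + colour χ g p₂ l₁)
                    leaves-square)

  zeroSumCopy-path₇-end : (g : V → Fin n) → Injective _≡_ _≡_ g → AltSquare χ (g q₀) (g q₁) (g p₂) (g q₂) →
    EndSwap χ (g p₁) (g q₀) (g l₁) (g p₂) (g l₂) → ZeroSumCopyB χ 1 3 1
  zeroSumCopy-path₇-end g g-inj middle-square ends≢ =
    zeroSumCopy-path₇ g g-inj (transpose _≟ᵥ_ p₁ l₂) (transpose-injective _≟ᵥ_ p₁ l₂)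
      (refl ∷ refl ∷ refl ∷ refl ∷ [])
      middle-square ends≢

module _ {n : ℕ} (χ : Coloring n) where

  record Cherry (S : Fin n → Set) : Set where
    field
      x y z : Fin n
      x∈S : S x
      y∈S : S y
      z∈S : S z
      x≢y : x ≢ y
      x≢z : x ≢ z
      y≢z : y ≢ z
      bicoloured : Bicoloured χ x z y

  cherry-at : ∀ {S x z y} → S x → S z → S y → z ≢ x → z ≢ y → Bicoloured χ x z y → Cherry S
  cherry-at {x = x} {z} {y} x∈S z∈S y∈S z≢x z≢y bic = record
    { x = x ; y = y ; z = z ; x∈S = x∈S ; y∈S = y∈S ; z∈S = z∈S
    ; x≢y = λ { refl → bic refl } ; x≢z = z≢x ∘ sym ; y≢z = z≢y ∘ sym ; bicoloured = bic }

  -- What zeroSumCopy-d₁≥2 needs when m = 1: then the neighbour of q₀ other than p₁ is p₂.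
  record Hub : Set where
    field
      p u q v w w′ : Fin n
      distinct : AllPairs _≢_ (p ∷ u ∷ q ∷ v ∷ w ∷ w′ ∷ [])
      square : AltSquare χ p u q v
      cherry : Bicoloured χ w q w′

  AltSquare-resp : ∀ {p u q v p′ u′ q′ v′} → p ≡ p′ → u ≡ u′ → q ≡ q′ → v ≡ v′ →
                   AltSquare χ p′ u′ q′ v′ → AltSquare χ p u q v
  AltSquare-resp refl refl refl refl square = square

  Bicoloured-resp : ∀ {x z y x′ z′ y′} → x ≡ x′ → z ≡ z′ → y ≡ y′ →
                    Bicoloured χ x′ z′ y′ → Bicoloured χ x z y
  Bicoloured-resp refl refl refl bic = bic

  EndSwap-resp : ∀ {p q k r l p′ q′ k′ r′ l′} → p ≡ p′ → q ≡ q′ → k ≡ k′ → r ≡ r′ → l ≡ l′ →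
                 EndSwap χ p′ q′ k′ r′ l′ → EndSwap χ p q k r l
  EndSwap-resp refl refl refl refl refl swap = swap

  zeroSumCopy-d₁≥2-of-hub : ∀ {k₁ k₂} (e : BVert (suc (suc k₁)) 1 (suc k₂) → Fin n) → Injective _≡_ _≡_ e →
    Hub → ZeroSumCopyB χ (suc (suc k₁)) 1 (suc k₂)
  zeroSumCopy-d₁≥2-of-hub {k₁} {k₂} e e-inj hub =
    case place-sends _≟_ rs vs e-inj (distinct-by-decision _≟ᵥ_ rs) distinct of λ where
      (g-p₁ ∷ g-l₁₀ ∷ g-p₂ ∷ g-l₂₀ ∷ g-q₀ ∷ g-l₁₁ ∷ []) →
        zeroSumCopy-d₁≥2 χ (place _≟_ e rs vs) (place-injective _≟_ rs vs e-inj)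
          (AltSquare-resp g-p₁ g-l₁₀ g-p₂ g-l₂₀ square) (Bicoloured-resp g-q₀ g-p₂ g-l₁₁ cherry)
    where
    open Hub hub
    rs : List (BVert (suc (suc k₁)) 1 (suc k₂))
    rs = p₁ ∷ leaf₁ zero ∷ p₂ ∷ leaf₂ zero ∷ int zero ∷ leaf₁ (suc zero) ∷ []
    vs : List (Fin n)
    vs = p ∷ u ∷ q ∷ v ∷ w ∷ w′ ∷ []

  zeroSumCopy-d₁≥2-of-square : ∀ {k₁ m k₂} (e : BVert (suc (suc k₁)) (suc (suc m)) (suc k₂) → Fin n) →
    Injective _≡_ _≡_ e → ∀ {P₁ L₁₀ P₂ L₂₀ Q₀ L₁₁ Q₁} →
    AllPairs _≢_ (P₁ ∷ L₁₀ ∷ P₂ ∷ L₂₀ ∷ Q₀ ∷ L₁₁ ∷ Q₁ ∷ []) →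
    AltSquare χ P₁ L₁₀ P₂ L₂₀ → Bicoloured χ Q₀ Q₁ L₁₁ → ZeroSumCopyB χ (suc (suc k₁)) (suc (suc m)) (suc k₂)
  zeroSumCopy-d₁≥2-of-square {k₁} {m} {k₂} e e-inj {P₁} {L₁₀} {P₂} {L₂₀} {Q₀} {L₁₁} {Q₁} distinct square cherry =
    case place-sends _≟_ rs vs e-inj (distinct-by-decision _≟ᵥ_ rs) distinct of λ where
      (g-p₁ ∷ g-l₁₀ ∷ g-p₂ ∷ g-l₂₀ ∷ g-q₀ ∷ g-l₁₁ ∷ g-q₁ ∷ []) →
        zeroSumCopy-d₁≥2 χ (place _≟_ e rs vs) (place-injective _≟_ rs vs e-inj)
          (AltSquare-resp g-p₁ g-l₁₀ g-p₂ g-l₂₀ square) (Bicoloured-resp g-q₀ g-q₁ g-l₁₁ cherry)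
    where
    rs : List (BVert (suc (suc k₁)) (suc (suc m)) (suc k₂))
    rs = p₁ ∷ leaf₁ zero ∷ p₂ ∷ leaf₂ zero ∷ int zero ∷ leaf₁ (suc zero) ∷ int (suc zero) ∷ []
    vs : List (Fin n)
    vs = P₁ ∷ L₁₀ ∷ P₂ ∷ L₂₀ ∷ Q₀ ∷ L₁₁ ∷ Q₁ ∷ []

module _ {n : ℕ} (χ : Coloring n) (χ-sym : Symmetric χ) where

  cherry-of-two-edges : ∀ {S x y z w} → S x → S y → S z → S w → x ≢ y → z ≢ w → χ x y ≢ χ z w → Cherry χ S
  cherry-of-two-edges {x = x} {y} {z} {w} x∈S y∈S z∈S w∈S x≢y z≢w xy≢zw with x ≟ z
  ... | yes refl = cherry-at χ y∈S x∈S w∈S x≢y z≢w (λ eq → xy≢zw (trans (χ-sym x y) (trans eq (χ-sym w x))))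
  ... | no x≢z with x ≟ w
  ...   | yes refl = cherry-at χ y∈S x∈S z∈S x≢y x≢z (λ eq → xy≢zw (trans (χ-sym x y) eq))
  ...   | no _ with y ≟ z
  ...     | yes refl = cherry-at χ x∈S y∈S w∈S (x≢y ∘ sym) z≢w (λ eq → xy≢zw (trans eq (χ-sym w y)))
  ...     | no y≢z with y ≟ w
  ...       | yes refl = cherry-at χ x∈S y∈S z∈S (x≢y ∘ sym) y≢z xy≢zw
  ...       | no _ with χ x y ≟ χ z y
  ...         | no xy≢zy = cherry-at χ x∈S y∈S z∈S (x≢y ∘ sym) y≢z xy≢zy
  ...         | yes xy≡zy = cherry-at χ y∈S z∈S w∈S (y≢z ∘ sym) z≢w
                  (λ eq → xy≢zw (trans xy≡zy (trans (χ-sym z y) (trans eq (χ-sym w z)))))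

  module _ (e : BVert 1 3 1 → Fin n) (e-inj : Injective _≡_ _≡_ e) {L₁ P₁ Q₀ Q₁ Q₂ P₂ L₂ : Fin n}
           (distinct : AllPairs _≢_ (L₁ ∷ P₁ ∷ Q₀ ∷ Q₁ ∷ Q₂ ∷ P₂ ∷ L₂ ∷ [])) where
    private
      rs : List (BVert 1 3 1)
      rs = leaf₁ zero ∷ p₁ ∷ int zero ∷ int (suc zero) ∷ int (suc (suc zero)) ∷ p₂ ∷ leaf₂ zero ∷ []
      vs : List (Fin n)
      vs = L₁ ∷ P₁ ∷ Q₀ ∷ Q₁ ∷ Q₂ ∷ P₂ ∷ L₂ ∷ []
      g : BVert 1 3 1 → Fin n
      g = place _≟_ e rs vs
      g-inj : Injective _≡_ _≡_ g
      g-inj = place-injective _≟_ rs vs e-inj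

    zeroSumCopy-path₇-of-squares : AltSquare χ Q₀ Q₁ P₂ Q₂ → AltSquare χ P₁ L₁ P₂ L₂ → ZeroSumCopyB χ 1 3 1
    zeroSumCopy-path₇-of-squares middle-square leaves-square =
      case place-sends _≟_ rs vs e-inj (distinct-by-decision _≟ᵥ_ rs) distinct of λ where
        (g-l₁ ∷ g-p₁ ∷ g-q₀ ∷ g-q₁ ∷ g-q₂ ∷ g-p₂ ∷ g-l₂ ∷ []) →
          zeroSumCopy-path₇-leaves χ χ-sym g g-inj
            (AltSquare-resp χ g-q₀ g-q₁ g-p₂ g-q₂ middle-square) (AltSquare-resp χ g-p₁ g-l₁ g-p₂ g-l₂ leaves-square)

    zeroSumCopy-path₇-of-end : AltSquare χ Q₀ Q₁ P₂ Q₂ → EndSwap χ P₁ Q₀ L₁ P₂ L₂ → ZeroSumCopyB χ 1 3 1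
    zeroSumCopy-path₇-of-end middle-square ends≢ =
      case place-sends _≟_ rs vs e-inj (distinct-by-decision _≟ᵥ_ rs) distinct of λ where
        (g-l₁ ∷ g-p₁ ∷ g-q₀ ∷ g-q₁ ∷ g-q₂ ∷ g-p₂ ∷ g-l₂ ∷ []) →
          zeroSumCopy-path₇-end χ χ-sym g g-inj
            (AltSquare-resp χ g-q₀ g-q₁ g-p₂ g-q₂ middle-square) (EndSwap-resp χ g-p₁ g-q₀ g-l₁ g-p₂ g-l₂ ends≢)

-- The alternating cycle C = c₀ c₁ c₂ c₃ together with a cherry x – z – y outside it; the
-- seven vertices are referred to by their positions in frame.
module Frame {n : ℕ} (χ : Coloring n) (χ-sym : Symmetric χ) (C : FourCycle n) (C-alt : Alternating χ C)
             (cherry : Cherry χ (λ v → ¬ InCycle C v)) where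

  open Cherry cherry
  open FourCycle C using () renaming (a to c₀; b to c₁; c to c₂; d to c₃;
    a≢b to c₀≢c₁; a≢c to c₀≢c₂; a≢d to c₀≢c₃; b≢c to c₁≢c₂; b≢d to c₁≢c₃; c≢d to c₂≢c₃)

  private
    frame : List (Fin n)
    frame = c₀ ∷ c₁ ∷ c₂ ∷ c₃ ∷ x ∷ y ∷ z ∷ []

    c₀≢ : ∀ {v} → ¬ InCycle C v → c₀ ≢ v
    c₀≢ v∉C = v∉C ∘ inj₁ ∘ sym
    c₁≢ : ∀ {v} → ¬ InCycle C v → c₁ ≢ v
    c₁≢ v∉C = v∉C ∘ inj₂ ∘ inj₁ ∘ sym
    c₂≢ : ∀ {v} → ¬ InCycle C v → c₂ ≢ v
    c₂≢ v∉C = v∉C ∘ inj₂ ∘ inj₂ ∘ inj₁ ∘ sym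
    c₃≢ : ∀ {v} → ¬ InCycle C v → c₃ ≢ v
    c₃≢ v∉C = v∉C ∘ inj₂ ∘ inj₂ ∘ inj₂ ∘ sym

    frame-distinct : AllPairs _≢_ frame
    frame-distinct =
        (c₀≢c₁ ∷ c₀≢c₂ ∷ c₀≢c₃ ∷ c₀≢ x∈S ∷ c₀≢ y∈S ∷ c₀≢ z∈S ∷ [])
      ∷ (c₁≢c₂ ∷ c₁≢c₃ ∷ c₁≢ x∈S ∷ c₁≢ y∈S ∷ c₁≢ z∈S ∷ [])
      ∷ (c₂≢c₃ ∷ c₂≢ x∈S ∷ c₂≢ y∈S ∷ c₂≢ z∈S ∷ [])
      ∷ (c₃≢ x∈S ∷ c₃≢ y∈S ∷ c₃≢ z∈S ∷ [])
      ∷ (x≢y ∷ x≢z ∷ [])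
      ∷ (y≢z ∷ [])
      ∷ []
      ∷ []

    pick : (is : List (Fin 7)) → {True (allPairs? (λ i j → ¬? (i ≟ j)) is)} → AllPairs _≢_ (map (lookup frame) is)
    pick is {distinct} = AllPairs.map⁺ (AllPairs.map (λ i≢j → i≢j ∘ lookup-injective frame-distinct) (toWitness distinct))

    square-C : AltSquare χ c₀ c₁ c₂ c₃
    square-C eq = C-alt (trans eq (trans (cong₂ _+₃_ (χ-sym c₀ c₃) (χ-sym c₂ c₁)) (+₃-comm (χ c₃ c₀) (χ c₁ c₂))))

    zx≢zy : χ z x ≢ χ z y
    zx≢zy eq = bicoloured (trans (χ-sym x z) (trans eq (χ-sym z y)))

    square-through : ∀ q → χ x q ≡ χ y q → AltSquare χ z x q y
    square-through q xq≡yq eq = +-cancelʳ-≢₃ (toℕ (χ q y)) (toℕ (χ z x)) (toℕ (χ z y)) (toℕ-≢₃ zx≢zy)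
      (trans eq (cong (λ u → (toℕ (χ z y) + toℕ u) % 3) (trans (χ-sym q x) (trans xq≡yq (χ-sym y q)))))

    hub : Hub χ
    hub with χ x c₀ ≟ χ y c₀
    ... | no bic = record { p = c₂ ; u = c₃ ; q = c₀ ; v = c₁ ; w = x ; w′ = y
                          ; distinct = pick (# 2 ∷ # 3 ∷ # 0 ∷ # 1 ∷ # 4 ∷ # 5 ∷ [])
                          ; square = AltSquare-sym χ c₀ c₁ c₂ c₃ square-C ; cherry = bic }
    ... | yes xc₀≡yc₀ with χ x c₂ ≟ χ y c₂
    ...   | no bic = record { p = c₀ ; u = c₁ ; q = c₂ ; v = c₃ ; w = x ; w′ = y
                            ; distinct = pick (# 0 ∷ # 1 ∷ # 2 ∷ # 3 ∷ # 4 ∷ # 5 ∷ [])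
                            ; square = square-C ; cherry = bic }
    ...   | yes xc₂≡yc₂ with χ c₁ c₀ ≟ χ c₃ c₀
    ...     | no bic = record { p = z ; u = x ; q = c₀ ; v = y ; w = c₁ ; w′ = c₃
                              ; distinct = pick (# 6 ∷ # 4 ∷ # 0 ∷ # 5 ∷ # 1 ∷ # 3 ∷ [])
                              ; square = square-through c₀ xc₀≡yc₀ ; cherry = bic }
    ...     | yes c₁c₀≡c₃c₀ with χ c₁ c₂ ≟ χ c₃ c₂
    ...       | no bic = record { p = z ; u = x ; q = c₂ ; v = y ; w = c₁ ; w′ = c₃
                                ; distinct = pick (# 6 ∷ # 4 ∷ # 2 ∷ # 5 ∷ # 1 ∷ # 3 ∷ [])
                                ; square = square-through c₂ xc₂≡yc₂ ; cherry = bic }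
    ...       | yes c₁c₂≡c₃c₂ = ⊥-elim (C-alt (begin
      χ c₀ c₁ +₃ χ c₂ c₃   ≡⟨ cong₂ _+₃_ (trans (χ-sym c₀ c₁) c₁c₀≡c₃c₀) (trans (χ-sym c₂ c₃) (sym c₁c₂≡c₃c₂)) ⟩
      χ c₃ c₀ +₃ χ c₁ c₂   ≡⟨ +₃-comm (χ c₃ c₀) (χ c₁ c₂) ⟩
      χ c₁ c₂ +₃ χ c₃ c₀   ∎))
      where open ≡-Reasoning

    copy-d₁≥2 : ∀ {k₁ m k₂} (e : BVert (suc (suc k₁)) (suc m) (suc k₂) → Fin n) → Injective _≡_ _≡_ e →
              ZeroSumCopyB χ (suc (suc k₁)) (suc m) (suc k₂)
    copy-d₁≥2 {m = zero}  e e-inj = zeroSumCopy-d₁≥2-of-hub χ e e-inj hub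
    copy-d₁≥2 {m = suc _} e e-inj =
      zeroSumCopy-d₁≥2-of-square χ e e-inj (pick (# 0 ∷ # 1 ∷ # 2 ∷ # 3 ∷ # 4 ∷ # 5 ∷ # 6 ∷ [])) square-C bicoloured

    copy-path₇ : (e : BVert 1 3 1 → Fin n) → Injective _≡_ _≡_ e → ZeroSumCopyB χ 1 3 1
    copy-path₇ e e-inj with (χ z x +₃ χ c₂ y) ℕ.≟ (χ z y +₃ χ c₂ x)
    ... | no leaves-square =
      zeroSumCopy-path₇-of-squares χ χ-sym e e-inj (pick (# 4 ∷ # 6 ∷ # 0 ∷ # 1 ∷ # 3 ∷ # 2 ∷ # 5 ∷ []))
        square-C leaves-square
    ... | yes shift-c₂ with (χ z x +₃ χ c₀ y) ℕ.≟ (χ z y +₃ χ c₀ x)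
    ...   | no leaves-square =
      zeroSumCopy-path₇-of-squares χ χ-sym e e-inj (pick (# 4 ∷ # 6 ∷ # 2 ∷ # 3 ∷ # 1 ∷ # 0 ∷ # 5 ∷ []))
        (AltSquare-sym χ c₀ c₁ c₂ c₃ square-C) leaves-square
    ...   | yes shift-c₀ =
      zeroSumCopy-path₇-of-end χ χ-sym e e-inj (pick (# 6 ∷ # 4 ∷ # 0 ∷ # 1 ∷ # 3 ∷ # 2 ∷ # 5 ∷ []))
        square-C
        (subst₂ _≢_ (cong₂ (λ s t → (toℕ s + (toℕ t + toℕ (χ c₂ y))) % 3) (χ-sym c₀ x) (χ-sym z x))
                    (cong₂ (λ s t → (toℕ s + (toℕ t + toℕ (χ c₂ x))) % 3) (χ-sym c₀ y) (χ-sym z y))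
                    (sums-differ-by-shift (χ z x) (χ z y) (χ c₂ x) (χ c₂ y) (χ c₀ x) (χ c₀ y) zx≢zy shift-c₂ shift-c₀))

  zeroSumCopy : ∀ d₁ d₂ m → 1 ≤ d₁ → 1 ≤ d₂ → 1 ≤ m → m ≤ 3 → 3 ∣ d₁ + d₂ + m + 1 →
                (e : BVert d₁ m d₂ → Fin n) → Injective _≡_ _≡_ e → ZeroSumCopyB χ d₁ m d₂
  zeroSumCopy (suc (suc _)) (suc _) (suc _) _ _ _ _ _ e e-inj = copy-d₁≥2 e e-inj
  zeroSumCopy 1 (suc (suc _)) (suc _) _ _ _ _ _ e e-inj =
    ZeroSumCopyB-mirror χ χ-sym (copy-d₁≥2 (e ∘ mirror) (mirror-injective ∘ e-inj))
  zeroSumCopy 1 1 3 _ _ _ _ _ e e-inj = copy-path₇ e e-inj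
  zeroSumCopy 1 1 1 _ _ _ _ 3∣4 = ⊥-elim (from-no (3 ∣? 4) 3∣4)
  zeroSumCopy 1 1 2 _ _ _ _ 3∣5 = ⊥-elim (from-no (3 ∣? 5) 3∣5)
  zeroSumCopy 1 1 (suc (suc (suc (suc _)))) _ _ _ (s≤s (s≤s (s≤s ())))
  zeroSumCopy zero _ _ ()
  zeroSumCopy (suc _) zero _ _ ()
  zeroSumCopy (suc _) (suc _) zero _ _ ()

proposition4p19 : (d₁ d₂ m : ℕ) → 1 ≤ d₁ → 1 ≤ d₂ → 1 ≤ m → m ≤ 3 →
    3 ∣ (d₁ + d₂ + m + 1) →
    (χ : Coloring (d₁ + d₂ + m + 2)) → Symmetric χ →
    αC4≥ χ 1 →
    Σ (FourCycle (d₁ + d₂ + m + 2)) (λ C → Alternating χ C × NotMonoOutside χ C) →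
    ZeroSumCopyB χ d₁ m d₂
proposition4p19 d₁ d₂ m 1≤d₁ 1≤d₂ 1≤m m≤3 3∣ χ χ-sym _
                (C , C-alt , x , y , z , w , x≢y , z≢w , x∉C , y∉C , z∉C , w∉C , xy≢zw) =
  Frame.zeroSumCopy χ χ-sym C C-alt (cherry-of-two-edges χ χ-sym x∉C y∉C z∉C w∉C x≢y z≢w xy≢zw)
    d₁ d₂ m 1≤d₁ 1≤d₂ 1≤m m≤3 3∣ (Injection.to BVert↣Fin) (Injection.injective BVert↣Fin)
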